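{- $\mathsf{WOP}(X\mapsto X^2_{lex}) \not\le_{\mathrm W} (\mathsf{LPO}')^*$.
   Context: A problem is a partial multi-valued function from instances to sets of solutions. $\mathsf P\le_{\mathrm W}\mathsf Q$ means there are Turing functionals $H,K$ such that for every $\mathsf P$-instance $X$, $H(X)$ is a $\mathsf Q$-instance, and for every $\mathsf Q$-solution $\hat Y$ to $H(X)$, $K(X\oplus\hat Y)$ is a $\mathsf P$-solution to $X$. The finite parallelization $\mathsf P^*$ has instances $\langle n,X_1,\dots,X_n\rangle$ with each $X_i$ a $\mathsf P$-instance, and solutions tuples $\langle Y_1,\dots,Y_n\rangle$ with $Y_i$ a $\mathsf P$-solution to $X_i$. $\mathsf{LPO}:2^{\mathbb N}\to\{0,1\}$ outputs $0$ on $p$ iff $p=0^{\mathbb N}$. $\mathsf{LPO}'$ takes as input (a code for) a sequence $\langle p_0,p_1,\dots\rangle$ of infinite binary sequences such that $p(i)=\lim_{s\to\infty}p_i(s)$ exists for every $i$, and outputs $\mathsf{LPO}(p)$. $\mathsf{WOP}(X\mapsto X^2_{lex})$: an instance is a linear order $X$ together with an infinite sequence $\sigma$ in $X^2$ strictly decreasing in the lexicographic order on $X^2$; a solution is an infinite strictly decreasing sequence in $X$ whose terms occur as components of terms of $\sigma$, in the same relative order. -}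

module Defs where

open import Data.Nat using (ℕ; zero; suc; _+_; _*_; _<_; _≤_)
open import Data.Fin using (Fin)
open import Data.Vec using (Vec; []; _∷_; lookup)
open import Data.Maybe using (Maybe; just; nothing; _>>=_)
open import Data.Product using (Σ; _×_; _,_; ∃; ∃-syntax)
open import Data.Sum using (_⊎_)
open import Relation.Binary.PropositionalEquality using (_≡_; _≢_)

Name : Set
Name = ℕ → ℕ

-- Join X ⊕ Y : (X ⊕ Y)(2n) = X n, (X ⊕ Y)(2n+1) = Y n.
_⊕_ : Name → Name → Name
(X ⊕ Y) zero = X zero
(X ⊕ Y) (suc zero) = Y zero
(X ⊕ Y) (suc (suc n)) = ((λ k → X (suc k)) ⊕ (λ k → Y (suc k))) n

tri : ℕ → ℕ
tri zero = 0
tri (suc n) = tri n + suc n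

pair : ℕ → ℕ → ℕ
pair i s = tri (i + s) + s

col : Name → ℕ → Name
col W i k = W (pair i k)

-- Oracle partial recursive functions (Kleene), with a fuel-bounded
-- interpreter.  A Turing functional is given by a code e : Code 1;
-- Φ_e^X(n) = m  iff  eval s e X [n] ≡ just m for some fuel s.

data Code : ℕ → Set where
  zer  : ∀ {n} → Code n
  succ : Code 1
  proj : ∀ {n} → Fin n → Code n
  orc  : Code 1
  comp : ∀ {m n} → Code m → Vec (Code n) m → Code n
  prec : ∀ {n} → Code n → Code (suc (suc n)) → Code (suc n)
  mu   : ∀ {n} → Code (suc n) → Code n

-- bounded search for the least i ≥ i₀ with f i = 0 (fails if some
-- earlier value is undefined)
search : ℕ → (ℕ → Maybe ℕ) → ℕ → Maybe ℕ
search zero f i = nothing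
search (suc b) f i = f i >>= λ { zero → just i ; (suc _) → search b f (suc i) }

mutual
  eval : ℕ → ∀ {n} → Code n → Name → Vec ℕ n → Maybe ℕ
  eval zero c X xs = nothing
  eval (suc s) zer X xs = just 0
  eval (suc s) succ X (x ∷ []) = just (suc x)
  eval (suc s) (proj i) X xs = just (lookup xs i)
  eval (suc s) orc X (x ∷ []) = just (X x)
  eval (suc s) (comp f gs) X xs = evalV s gs X xs >>= λ ys → eval s f X ys
  eval (suc s) (prec f g) X (zero ∷ xs) = eval s f X xs
  eval (suc s) (prec f g) X (suc k ∷ xs) =
    eval s (prec f g) X (k ∷ xs) >>= λ r → eval s g X (k ∷ r ∷ xs)
  eval (suc s) (mu f) X xs = search s (λ i → eval s f X (i ∷ xs)) 0

  evalV : ℕ → ∀ {m n} → Vec (Code n) m → Name → Vec ℕ n → Maybe (Vec ℕ m)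
  evalV s [] X xs = just []
  evalV s (g ∷ gs) X xs =
    eval s g X xs >>= λ y → evalV s gs X xs >>= λ ys → just (y ∷ ys)

Computes : Code 1 → Name → Name → Set
Computes e X Y = ∀ n → ∃[ s ] eval s e X (n ∷ []) ≡ just (Y n)

record Problem : Set₁ where
  field
    Inst : Name → Set
    Sol  : Name → Name → Set
open Problem public

_≤W_ : Problem → Problem → Set
P ≤W Q = Σ (Code 1) λ H → Σ (Code 1) λ K →
  ∀ X → Inst P X →
    Σ Name λ HX → Computes H X HX × Inst Q HX ×
      (∀ Ŷ → Sol Q HX Ŷ → Σ Name λ Z → Computes K (X ⊕ Ŷ) Z × Sol P X Z)

-- P* : instance ⟨n, X₀, …, X_{n-1}⟩ coded by W with W 0 = n and
-- X_i = col (W ∘ suc) i ; solution ⟨Y₀,…⟩ coded by Z with Y_i = col Z i.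
_* : Problem → Problem
Inst (P *) W = ∀ i → i < W 0 → Inst P (col (λ k → W (suc k)) i)
Sol  (P *) W Z = ∀ i → i < W 0 → Sol P (col (λ k → W (suc k)) i) (col Z i)

-- LPO′ : instance p coding ⟨p₀,p₁,…⟩ with p_i = col p i binary and
-- lim_s p_i(s) existing for all i; output LPO(lim p) as the value Z 0.

LimIs : Name → ℕ → ℕ → Set
LimIs p i b = ∃[ s₀ ] ∀ s → s₀ ≤ s → col p i s ≡ b

LPO′ : Problem
Inst LPO′ p = (∀ n → p n ≤ 1) × (∀ i → ∃[ b ] LimIs p i b)
Sol  LPO′ p Z = (Z 0 ≡ 0 × (∀ i → LimIs p i 0))
              ⊎ (Z 0 ≡ 1 × ∃[ i ] LimIs p i 1)

-- WOP(X ↦ X²_lex).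
-- An instance W codes a linear order (RCA₀-style) by
--   a ≤_X b  iff  col W 0 (pair a b) ≡ 1 ,  field = {a | a ≤_X a},
-- and the sequence σ with σ_n = (col W 1 n , col W 2 n).

LeqX : Name → ℕ → ℕ → Set
LeqX W a b = col W 0 (pair a b) ≡ 1

FieldX : Name → ℕ → Set
FieldX W a = LeqX W a a

LtX : Name → ℕ → ℕ → Set
LtX W a b = LeqX W a b × a ≢ b

IsLinearOrder : Name → Set
IsLinearOrder W =
    (∀ a b → LeqX W a b → FieldX W a × FieldX W b)
  × (∀ a b → LeqX W a b → LeqX W b a → a ≡ b)
  × (∀ a b c → LeqX W a b → LeqX W b c → LeqX W a c)
  × (∀ a b → FieldX W a → FieldX W b → LeqX W a b ⊎ LeqX W b a)

σ₁ σ₂ : Name → Name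
σ₁ W = col W 1
σ₂ W = col W 2

LtLex : Name → ℕ × ℕ → ℕ × ℕ → Set
LtLex W (a , b) (c , d) = LtX W a c ⊎ (a ≡ c × LtX W b d)

flat : Name → Name
flat W = σ₁ W ⊕ σ₂ W

WOPlex2 : Problem
Inst WOPlex2 W = IsLinearOrder W
  × (∀ n → FieldX W (σ₁ W n) × FieldX W (σ₂ W n))
  × (∀ n → LtLex W (σ₁ W (suc n) , σ₂ W (suc n)) (σ₁ W n , σ₂ W n))
Sol WOPlex2 W Z = (∀ n → LtX W (Z (suc n)) (Z n))
  × Σ (ℕ → ℕ) λ g → (∀ n → g n < g (suc n)) × (∀ n → Z n ≡ flat W (g n))

module Submission where

-- All instances X[ ts ] share one linear order, on points A l and B l n, and differ only in
-- σ k = (A p , B p k), where the phase p = phase ts k is a step function that increases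
-- at the switching times ts. A descending sequence through the components of σ can take
-- only finitely many A-points, must then continue with B-points of non-increasing phase,
-- and visits arbitrarily late σ-indices; hence its first B-point has the final phase
-- length ts, i.e. every solution reveals how many switches the instance has.
--
-- Against a reduction (H , K): H fixes the number of LPO′-instances after reading a finite
-- part of the input, so only finitely many 0-1 answers Y need to be considered. Whenever K
-- on some Y reveals the current number of phases, it has read only a finite part of the
-- input, and adding one more switch beyond that part makes this revelation permanently
-- wrong. After at most as many switches as there are answers, no answer reveals the phase
-- count, yet (classically) one of them is a correct LPO′* solution, which K must turn into
-- a solution of the WOP-instance.

open import Defs
open import Relation.Nullary using (¬_)

open import Data.Nat using (ℕ; zero; suc; _+_; _<_; _≤_; _⊔_; _≟_; _≤?_; z≤n; s≤s; _≤′_; ≤′-refl; ≤′-step)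
open import Data.Nat.Properties
open import Data.Vec using (Vec; []; _∷_)
open import Data.Maybe using (Maybe; just; nothing; _>>=_)
open import Data.Maybe.Properties using (just-injective)
open import Data.Product using (Σ; _×_; _,_; proj₁; proj₂)
open import Data.Sum using (_⊎_; inj₁; inj₂; [_,_]′)
import Data.Sum
open import Data.List using (List; []; _∷_; length; map; _++_; removeAt)
open import Data.List.Properties using (length-removeAt′)
open import Data.List.Membership.Propositional using (_∈_)
open import Data.List.Membership.Propositional.Properties using (∈-map⁺; ∈-++⁺ˡ; ∈-++⁺ʳ)
open import Data.List.Relation.Unary.Any using (here; there; index)
open import Relation.Nullary.Decidable using (¬¬-excluded-middle)
open import Data.Empty using (⊥; ⊥-elim)
open import Data.Unit using (⊤; tt)
open import Relation.Nullary using (Dec; yes; no)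
open import Relation.Binary using (tri<; tri≈; tri>)
open import Relation.Binary.PropositionalEquality
  using (_≡_; _≢_; refl; sym; trans; cong; cong₂; subst; subst₂)

pair-suc : ∀ i s → pair i (suc s) ≡ suc (pair (suc i) s)
pair-suc i s = trans (cong (λ z → tri z + suc s) (+-suc i s)) (+-suc (tri (suc (i + s))) s)

pair-suc-zero : ∀ s → pair (suc s) 0 ≡ suc (pair 0 s)
pair-suc-zero s = trans (+-identityʳ (tri (suc s + 0)))
  (trans (cong (λ z → tri (suc z)) (+-identityʳ s)) (+-suc (tri s) s))

nextPair : ℕ × ℕ → ℕ × ℕ
nextPair (zero  , s) = suc s , 0
nextPair (suc i , s) = i , suc s

unpair : ℕ → ℕ × ℕ
unpair zero    = 0 , 0
unpair (suc m) = nextPair (unpair m)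

pair-nextPair : ∀ i s → let (i′ , s′) = nextPair (i , s) in pair i′ s′ ≡ suc (pair i s)
pair-nextPair zero    s = pair-suc-zero s
pair-nextPair (suc i) s = pair-suc i s

pair-unpair : ∀ m → pair (proj₁ (unpair m)) (proj₂ (unpair m)) ≡ m
pair-unpair zero    = refl
pair-unpair (suc m) with unpair m | pair-unpair m
... | i , s | eq = trans (pair-nextPair i s) (cong suc eq)

unpair-pair : ∀ i s → unpair (pair i s) ≡ (i , s)
unpair-pair i s = diagonal (i + s) i s refl
  where
  diagonal : ∀ d i s → i + s ≡ d → unpair (pair i s) ≡ (i , s)
  diagonal d       zero    zero    _  = refl
  diagonal zero    (suc i) zero    ()
  diagonal (suc d) (suc i) zero    eq = trans (cong unpair (pair-suc-zero i))
    (cong nextPair (diagonal d 0 i (trans (sym (+-identityʳ i)) (suc-injective eq))))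
  diagonal d       i       (suc s) eq = trans (cong unpair (pair-suc i s))
    (cong nextPair (diagonal d (suc i) s (trans (sym (+-suc i s)) eq)))

s≤pair : ∀ i s → s ≤ pair i s
s≤pair i s = m≤n+m s (tri (i + s))

double : ℕ → ℕ
double zero    = zero
double (suc k) = suc (suc (double k))

n≤double : ∀ k → k ≤ double k
n≤double zero    = z≤n
n≤double (suc k) = s≤s (≤-trans (n≤double k) (n≤1+n _))

double-cancel-≤ : ∀ a b → double a ≤ double b → a ≤ b
double-cancel-≤ zero    b       _               = z≤n
double-cancel-≤ (suc a) (suc b) (s≤s (s≤s le)) = s≤s (double-cancel-≤ a b le)

even⊎odd : ∀ p → Σ ℕ λ k → p ≡ double k ⊎ p ≡ suc (double k)
even⊎odd zero = 0 , inj₁ refl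
even⊎odd (suc p) with even⊎odd p
... | k , inj₁ e = k     , inj₂ (cong suc e)
... | k , inj₂ e = suc k , inj₁ (cong suc e)

⊕-double : ∀ (X Y : Name) k → (X ⊕ Y) (double k) ≡ X k
⊕-double X Y zero    = refl
⊕-double X Y (suc k) = ⊕-double (λ n → X (suc n)) (λ n → Y (suc n)) k

⊕-suc-double : ∀ (X Y : Name) k → (X ⊕ Y) (suc (double k)) ≡ Y k
⊕-suc-double X Y zero    = refl
⊕-suc-double X Y (suc k) = ⊕-suc-double (λ n → X (suc n)) (λ n → Y (suc n)) k

-- The use principle

infix 4 _≈[_]_

_≈[_]_ : Name → ℕ → Name → Set
O ≈[ u ] O′ = ∀ m → m < u → O m ≡ O′ m

≈-refl : ∀ {O u} → O ≈[ u ] O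
≈-refl m _ = refl

≈-trans : ∀ {O O′ O″ u} → O ≈[ u ] O′ → O′ ≈[ u ] O″ → O ≈[ u ] O″
≈-trans p q m m<u = trans (p m m<u) (q m m<u)

≈-mono : ∀ {O O′ u v} → v ≤ u → O ≈[ u ] O′ → O ≈[ v ] O′
≈-mono v≤u p m m<v = p m (<-≤-trans m<v v≤u)

≈-⊕ : ∀ {X X′ u} Y → X ≈[ u ] X′ → (X ⊕ Y) ≈[ u ] (X′ ⊕ Y)
≈-⊕ {X} {X′} Y p m m<u with even⊎odd m
... | k , inj₁ refl = trans (⊕-double X Y k)
  (trans (p k (≤-<-trans (n≤double k) m<u)) (sym (⊕-double X′ Y k)))
... | k , inj₂ refl = trans (⊕-suc-double X Y k) (sym (⊕-suc-double X′ Y k))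

Locally : (Name → Set) → Name → Set
Locally P O = Σ ℕ λ u → ∀ O′ → O ≈[ u ] O′ → P O′

locally-× : ∀ {P Q O} → Locally P O → Locally Q O → Locally (λ O′ → P O′ × Q O′) O
locally-× (u , p) (v , q) = u ⊔ v , λ O′ ag →
  p O′ (≈-mono (m≤m⊔n u v) ag) , q O′ (≈-mono (m≤n⊔m u v) ag)

locally-map : ∀ {P Q : Name → Set} {O} → (∀ {O′} → P O′ → Q O′) → Locally P O → Locally Q O
locally-map f (u , p) = u , λ O′ ag → f (p O′ ag)

HasUse : {A : Set} → (Name → Maybe A) → Name → Set
HasUse F O = Locally (λ O′ → F O′ ≡ F O) O

constant-hasUse : ∀ {A : Set} {F : Name → Maybe A} {O} → (∀ O′ → F O′ ≡ F O) → HasUse F O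
constant-hasUse c = 0 , λ O′ _ → c O′

>>=-nothing : ∀ {A B : Set} {m : Maybe A} {k : A → Maybe B} → m ≡ nothing → (m >>= k) ≡ nothing
>>=-nothing refl = refl

>>=-just : ∀ {A B : Set} {m : Maybe A} {k : A → Maybe B} {a} → m ≡ just a → (m >>= k) ≡ k a
>>=-just refl = refl

>>=-just⁻¹ : ∀ {A B : Set} (m : Maybe A) (k : A → Maybe B) {v} → (m >>= k) ≡ just v →
  Σ A λ a → m ≡ just a × k a ≡ just v
>>=-just⁻¹ (just a) k e = a , refl , e

>>=-hasUse : ∀ {A B : Set} (M : Name → Maybe A) (k : Name → A → Maybe B) O →
  HasUse M O → (∀ a → HasUse (λ O′ → k O′ a) O) → HasUse (λ O′ → M O′ >>= k O′) O
>>=-hasUse M k O useM useK with M O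
... | nothing = locally-map >>=-nothing useM
... | just a  = locally-map (λ (e₁ , e₂) → trans (>>=-just e₁) e₂) (locally-× useM (useK a))

search-hasUse : ∀ b (F : Name → ℕ → Maybe ℕ) O → (∀ i → HasUse (λ O′ → F O′ i) O) →
  ∀ i → HasUse (λ O′ → search b (F O′) i) O
search-hasUse zero    F O useF i = constant-hasUse λ _ → refl
search-hasUse (suc b) F O useF i with F O i in eq
... | nothing      = locally-map (λ e → >>=-nothing (trans e eq)) (useF i)
... | just zero    = locally-map (λ e → >>=-just (trans e eq)) (useF i)
... | just (suc _) = locally-map (λ (e₁ , e₂) → trans (>>=-just (trans e₁ eq)) e₂)
  (locally-× (useF i) (search-hasUse b F O useF (suc i)))

mutual
  eval-hasUse : ∀ s {n} (c : Code n) O xs → HasUse (λ O′ → eval s c O′ xs) O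
  eval-hasUse zero    c        O xs       = constant-hasUse λ _ → refl
  eval-hasUse (suc s) zer      O xs       = constant-hasUse λ _ → refl
  eval-hasUse (suc s) succ     O (x ∷ []) = constant-hasUse λ _ → refl
  eval-hasUse (suc s) (proj i) O xs       = constant-hasUse λ _ → refl
  eval-hasUse (suc s) orc      O (x ∷ []) = suc x , λ O′ ag → cong just (sym (ag x ≤-refl))
  eval-hasUse (suc s) (comp f gs) O xs =
    >>=-hasUse (λ O′ → evalV s gs O′ xs) (λ O′ ys → eval s f O′ ys) O
      (evalV-hasUse s gs O xs) (λ ys → eval-hasUse s f O ys)
  eval-hasUse (suc s) (prec f g) O (zero ∷ xs) = eval-hasUse s f O xs
  eval-hasUse (suc s) (prec f g) O (suc k ∷ xs) =
    >>=-hasUse (λ O′ → eval s (prec f g) O′ (k ∷ xs)) (λ O′ r → eval s g O′ (k ∷ r ∷ xs)) O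
      (eval-hasUse s (prec f g) O (k ∷ xs)) (λ r → eval-hasUse s g O (k ∷ r ∷ xs))
  eval-hasUse (suc s) (mu f) O xs =
    search-hasUse s (λ O′ i → eval s f O′ (i ∷ xs)) O (λ i → eval-hasUse s f O (i ∷ xs)) 0

  evalV-hasUse : ∀ s {m n} (gs : Vec (Code n) m) O xs → HasUse (λ O′ → evalV s gs O′ xs) O
  evalV-hasUse s []       O xs = constant-hasUse λ _ → refl
  evalV-hasUse s (g ∷ gs) O xs = locally-map
    (λ (e₁ , e₂) → cong₂ (λ a b → a >>= λ y → b >>= λ ys → just (y ∷ ys)) e₁ e₂)
    (locally-× (eval-hasUse s g O xs) (evalV-hasUse s gs O xs))

search-mono : ∀ b (F G : ℕ → Maybe ℕ) → (∀ i w → F i ≡ just w → G i ≡ just w) →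
  ∀ i v → search b F i ≡ just v → search (suc b) G i ≡ just v
search-mono (suc b) F G F⊆G i v e with >>=-just⁻¹ (F i) _ e
... | zero  , e₁ , e₂ = trans (>>=-just (F⊆G i zero e₁)) e₂
... | suc w , e₁ , e₂ = trans (>>=-just (F⊆G i (suc w) e₁)) (search-mono b F G F⊆G (suc i) v e₂)

mutual
  eval-suc : ∀ s {n} (c : Code n) O xs v → eval s c O xs ≡ just v → eval (suc s) c O xs ≡ just v
  eval-suc (suc s) zer      O xs       v e = e
  eval-suc (suc s) succ     O (x ∷ []) v e = e
  eval-suc (suc s) (proj i) O xs       v e = e
  eval-suc (suc s) orc      O (x ∷ []) v e = e
  eval-suc (suc s) (comp f gs) O xs v e with >>=-just⁻¹ (evalV s gs O xs) _ e
  ... | ys , e₁ , e₂ = trans (>>=-just (evalV-suc s gs O xs ys e₁)) (eval-suc s f O ys v e₂)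
  eval-suc (suc s) (prec f g) O (zero ∷ xs) v e = eval-suc s f O xs v e
  eval-suc (suc s) (prec f g) O (suc k ∷ xs) v e with >>=-just⁻¹ (eval s (prec f g) O (k ∷ xs)) _ e
  ... | r , e₁ , e₂ =
    trans (>>=-just (eval-suc s (prec f g) O (k ∷ xs) r e₁)) (eval-suc s g O _ v e₂)
  eval-suc (suc s) (mu f) O xs v e =
    search-mono s (λ i → eval s f O (i ∷ xs)) (λ i → eval (suc s) f O (i ∷ xs))
      (λ i w → eval-suc s f O (i ∷ xs) w) 0 v e

  evalV-suc : ∀ s {m n} (gs : Vec (Code n) m) O xs vs →
    evalV s gs O xs ≡ just vs → evalV (suc s) gs O xs ≡ just vs
  evalV-suc s []       O xs vs e = e
  evalV-suc s (g ∷ gs) O xs vs e with >>=-just⁻¹ (eval s g O xs) _ e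
  ... | y , e₁ , e₂ with >>=-just⁻¹ (evalV s gs O xs) _ e₂
  ... | ys , e₃ , e₄ =
    trans (>>=-just (eval-suc s g O xs y e₁)) (trans (>>=-just (evalV-suc s gs O xs ys e₃)) e₄)

eval-mono : ∀ {s s′} {n} (c : Code n) O xs {v} → s ≤′ s′ →
  eval s c O xs ≡ just v → eval s′ c O xs ≡ just v
eval-mono c O xs ≤′-refl      e = e
eval-mono c O xs (≤′-step le) e = eval-suc _ c O xs _ (eval-mono c O xs le e)

eval-deterministic : ∀ {s s′} {n} (c : Code n) O xs {a b} →
  eval s c O xs ≡ just a → eval s′ c O xs ≡ just b → a ≡ b
eval-deterministic {s} {s′} c O xs e e′ = just-injective (trans
  (sym (eval-mono c O xs (≤⇒≤′ (m≤m⊔n s s′)) e)) (eval-mono c O xs (≤⇒≤′ (m≤n⊔m s s′)) e′))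

-- The instances X[ ts ]

data Point : Set where
  A : ℕ → Point
  B : ℕ → ℕ → Point

encode : Point → ℕ
encode (A l)   = pair 0 l
encode (B l n) = pair (suc l) n

decodePair : ℕ × ℕ → Point
decodePair (zero  , l) = A l
decodePair (suc l , n) = B l n

decode : ℕ → Point
decode m = decodePair (unpair m)

decode-encode : ∀ x → decode (encode x) ≡ x
decode-encode (A l)   = cong decodePair (unpair-pair 0 l)
decode-encode (B l n) = cong decodePair (unpair-pair (suc l) n)

encode-decode : ∀ m → encode (decode m) ≡ m
encode-decode m with unpair m | pair-unpair m
... | zero  , l | eq = eq
... | suc l , n | eq = eq

encode-injective : ∀ {x y} → encode x ≡ encode y → x ≡ y
encode-injective {x} {y} eq = trans (sym (decode-encode x)) (trans (cong decode eq) (decode-encode y))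

A-injective : ∀ {l l′} → A l ≡ A l′ → l ≡ l′
A-injective refl = refl

infix 4 _≼_

_≼_ : Point → Point → Set
A l   ≼ A l′    = l′ ≤ l
A _   ≼ B _ _   = ⊥
B _ _ ≼ A _     = ⊤
B l n ≼ B l′ n′ = l < l′ ⊎ (l ≡ l′ × n′ ≤ n)

_≼?_ : ∀ x y → Dec (x ≼ y)
A l   ≼? A l′    = l′ ≤? l
A _   ≼? B _ _   = no λ ()
B _ _ ≼? A _     = yes tt
B l n ≼? B l′ n′ with suc l ≤? l′ | l ≟ l′ | n′ ≤? n
... | yes l<l′ | _        | _        = yes (inj₁ l<l′)
... | no  l≮l′ | yes refl | yes n′≤n = yes (inj₂ (refl , n′≤n))
... | no  l≮l′ | yes refl | no  n′≰n = no λ { (inj₁ l<l′) → l≮l′ l<l′ ; (inj₂ (_ , n′≤n)) → n′≰n n′≤n }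
... | no  l≮l′ | no  l≢l′ | _        = no λ { (inj₁ l<l′) → l≮l′ l<l′ ; (inj₂ (l≡l′ , _)) → l≢l′ l≡l′ }

≼-refl : ∀ x → x ≼ x
≼-refl (A l)   = ≤-refl
≼-refl (B l n) = inj₂ (refl , ≤-refl)

≼-trans : ∀ x y z → x ≼ y → y ≼ z → x ≼ z
≼-trans (A _)   (A _)   (A _)   p q = ≤-trans q p
≼-trans (B _ _) _       (A _)   p q = tt
≼-trans (B _ _) (B _ _) (B _ _) (inj₁ p)        (inj₁ q)        = inj₁ (<-trans p q)
≼-trans (B _ _) (B _ _) (B _ _) (inj₁ p)        (inj₂ (refl , _)) = inj₁ p
≼-trans (B _ _) (B _ _) (B _ _) (inj₂ (refl , _)) (inj₁ q)        = inj₁ q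
≼-trans (B _ _) (B _ _) (B _ _) (inj₂ (refl , p)) (inj₂ (refl , q)) = inj₂ (refl , ≤-trans q p)

≼-antisym : ∀ x y → x ≼ y → y ≼ x → x ≡ y
≼-antisym (A _)   (A _)   p q = cong A (≤-antisym q p)
≼-antisym (B l _) (B _ _) (inj₁ p)          (inj₁ q)          = ⊥-elim (<-asym p q)
≼-antisym (B l _) (B _ _) (inj₁ p)          (inj₂ (refl , _)) = ⊥-elim (n≮n l p)
≼-antisym (B l _) (B _ _) (inj₂ (refl , _)) (inj₁ q)          = ⊥-elim (n≮n l q)
≼-antisym (B l _) (B _ _) (inj₂ (refl , p)) (inj₂ (_ , q))    = cong (B l) (≤-antisym q p)

≼-total : ∀ x y → x ≼ y ⊎ y ≼ x
≼-total (A l)   (A l′)   = Data.Sum.swap (≤-total l l′)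
≼-total (A _)   (B _ _)  = inj₂ tt
≼-total (B _ _) (A _)    = inj₁ tt
≼-total (B l n) (B l′ n′) with <-cmp l l′
... | tri< l<l′ _ _ = inj₁ (inj₁ l<l′)
... | tri> _ _ l′<l = inj₂ (inj₁ l′<l)
... | tri≈ _ refl _ with ≤-total n n′
...   | inj₁ n≤n′ = inj₂ (inj₂ (refl , n≤n′))
...   | inj₂ n′≤n = inj₁ (inj₂ (refl , n′≤n))

-- A schedule lists phase-switching times, latest first; when the times decrease along the
-- list, phase ts n is the number of switches at or before time n.
phase : List ℕ → ℕ → ℕ
phase []       n = 0
phase (t ∷ ts) n with t ≤? n
... | yes _ = suc (length ts)
... | no  _ = phase ts n

phase-≤-length : ∀ ts n → phase ts n ≤ length ts
phase-≤-length []       n = z≤n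
phase-≤-length (t ∷ ts) n with t ≤? n
... | yes _ = ≤-refl
... | no  _ = m≤n⇒m≤1+n (phase-≤-length ts n)

phase-mono : ∀ ts n → phase ts n ≤ phase ts (suc n)
phase-mono []       n = z≤n
phase-mono (t ∷ ts) n with t ≤? n | t ≤? suc n
... | yes _   | yes _    = ≤-refl
... | yes t≤n | no  t≰1+n = ⊥-elim (t≰1+n (m≤n⇒m≤1+n t≤n))
... | no  _   | yes _    = m≤n⇒m≤1+n (phase-≤-length ts n)
... | no  _   | no  _    = phase-mono ts n

phase-before : ∀ t ts n → n < t → phase (t ∷ ts) n ≡ phase ts n
phase-before t ts n n<t with t ≤? n
... | yes t≤n = ⊥-elim (<⇒≱ n<t t≤n)
... | no  _   = refl

phase-after : ∀ t ts n → t ≤ n → phase (t ∷ ts) n ≡ length (t ∷ ts)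
phase-after t ts n t≤n with t ≤? n
... | yes _   = refl
... | no  t≰n = ⊥-elim (t≰n t≤n)

phase-eventually-length : ∀ ts m → phase ts m < length ts →
  Σ ℕ λ t → ∀ n → t ≤ n → phase ts n ≡ length ts
phase-eventually-length (t ∷ ts) m _ = t , phase-after t ts

indicator : ∀ {P : Set} → Dec P → ℕ
indicator (yes _) = 1
indicator (no  _) = 0

indicator≡1⇒ : ∀ {P : Set} (d : Dec P) → indicator d ≡ 1 → P
indicator≡1⇒ (yes p) _ = p

indicator≡1⇐ : ∀ {P : Set} (d : Dec P) → P → indicator d ≡ 1
indicator≡1⇐ (yes _) _ = refl
indicator≡1⇐ (no ¬p) p = ⊥-elim (¬p p)

entry : List ℕ → ℕ × ℕ → ℕ
entry ts (0 , k) = let (a , b) = unpair k in indicator (decode a ≼? decode b)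
entry ts (1 , k) = encode (A (phase ts k))
entry ts (2 , k) = encode (B (phase ts k) k)
entry ts (_ , _) = 0

X[_] : List ℕ → Name
X[ ts ] m = entry ts (unpair m)

col-X : ∀ ts c k → col X[ ts ] c k ≡ entry ts (c , k)
col-X ts c k = cong (entry ts) (unpair-pair c k)

LeqX⇔≼ : ∀ ts a b → (LeqX X[ ts ] a b → decode a ≼ decode b) × (decode a ≼ decode b → LeqX X[ ts ] a b)
LeqX⇔≼ ts a b = (λ eq → indicator≡1⇒ (decode a ≼? decode b) (trans (sym entry-ab) eq))
              , (λ le → trans entry-ab (indicator≡1⇐ (decode a ≼? decode b) le))
  where
  entry-ab : col X[ ts ] 0 (pair a b) ≡ indicator (decode a ≼? decode b)
  entry-ab = trans (col-X ts 0 (pair a b)) (cong (λ (a , b) → indicator (decode a ≼? decode b)) (unpair-pair a b))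

LtX-encode⇒ : ∀ ts x y → LtX X[ ts ] (encode x) (encode y) → x ≼ y × x ≢ y
LtX-encode⇒ ts x y (le , ne) =
  subst₂ _≼_ (decode-encode x) (decode-encode y) (proj₁ (LeqX⇔≼ ts (encode x) (encode y)) le) ,
  λ x≡y → ne (cong encode x≡y)

LtX-encode⇐ : ∀ ts x y → x ≼ y → x ≢ y → LtX X[ ts ] (encode x) (encode y)
LtX-encode⇐ ts x y le ne =
  proj₂ (LeqX⇔≼ ts (encode x) (encode y)) (subst₂ _≼_ (sym (decode-encode x)) (sym (decode-encode y)) le) ,
  λ eq → ne (encode-injective eq)

X[]-field : ∀ ts a → FieldX X[ ts ] a
X[]-field ts a = proj₂ (LeqX⇔≼ ts a a) (≼-refl (decode a))

X[]-linearOrder : ∀ ts → IsLinearOrder X[ ts ]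
X[]-linearOrder ts =
    (λ a b _ → X[]-field ts a , X[]-field ts b)
  , (λ a b p q → trans (sym (encode-decode a))
      (trans (cong encode (≼-antisym (decode a) (decode b) (toOrder a b p) (toOrder b a q))) (encode-decode b)))
  , (λ a b c p q → fromOrder a c (≼-trans (decode a) (decode b) (decode c) (toOrder a b p) (toOrder b c q)))
  , (λ a b _ _ → Data.Sum.map (fromOrder a b) (fromOrder b a) (≼-total (decode a) (decode b)))
  where
  toOrder : ∀ a b → LeqX X[ ts ] a b → decode a ≼ decode b
  toOrder a b = proj₁ (LeqX⇔≼ ts a b)
  fromOrder : ∀ a b → decode a ≼ decode b → LeqX X[ ts ] a b
  fromOrder a b = proj₂ (LeqX⇔≼ ts a b)

σ-descends : ∀ ts n → LtLex X[ ts ] (σ₁ X[ ts ] (suc n) , σ₂ X[ ts ] (suc n)) (σ₁ X[ ts ] n , σ₂ X[ ts ] n)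
σ-descends ts n
  rewrite col-X ts 1 (suc n) | col-X ts 2 (suc n) | col-X ts 1 n | col-X ts 2 n
  with phase ts n ≟ phase ts (suc n)
... | yes p≡q rewrite p≡q =
  inj₂ (refl , LtX-encode⇐ ts (B _ (suc n)) (B _ n) (inj₂ (refl , n≤1+n n)) λ ())
... | no  p≢q =
  inj₁ (LtX-encode⇐ ts (A _) (A _) (phase-mono ts n) λ q≡p → p≢q (sym (A-injective q≡p)))

X[]-instance : ∀ ts → Inst WOPlex2 X[ ts ]
X[]-instance ts =
  X[]-linearOrder ts , (λ n → X[]-field ts (σ₁ X[ ts ] n) , X[]-field ts (σ₂ X[ ts ] n)) , σ-descends ts

-- Solutions reveal the number of phases

IsB : ℕ → Set
IsB v = Σ ℕ λ l → Σ ℕ λ n → v ≡ encode (B l n)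

-- F is the graph of a partial sequence (a solution, or the output of K).
RevealsPhase : (ℕ → ℕ → Set) → ℕ → Set
RevealsPhase F L = Σ ℕ λ j → (∀ k → k < j → Σ ℕ λ v → F k v × ¬ IsB v) × Σ ℕ λ n → F j (encode (B L n))

revealsPhase-map : ∀ {F G : ℕ → ℕ → Set} {L} → (∀ {k v} → F k v → G k v) →
  RevealsPhase F L → RevealsPhase G L
revealsPhase-map F⊆G (j , before , n , Fj) =
  j , (λ k k<j → let (v , Fk , ¬B) = before k k<j in v , F⊆G Fk , ¬B) , n , F⊆G Fj

revealsPhase-unique : ∀ {F : ℕ → ℕ → Set} {L L′} → (∀ {k v w} → F k v → F k w → v ≡ w) →
  RevealsPhase F L → RevealsPhase F L′ → L ≡ L′
revealsPhase-unique {L = L} {L′} functional (j , before , n , Fj) (j′ , before′ , n′ , Fj′)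
  with <-cmp j j′
... | tri< j<j′ _ _ = let (v , Fv , ¬B) = before′ j j<j′ in ⊥-elim (¬B (L , n , functional Fv Fj))
... | tri> _ _ j′<j = let (v , Fv , ¬B) = before j′ j′<j in ⊥-elim (¬B (L′ , n′ , functional Fv Fj′))
... | tri≈ _ refl _ = B-phase-injective (encode-injective (functional Fj Fj′))
  where
  B-phase-injective : ∀ {n n′} → B L n ≡ B L′ n′ → L ≡ L′
  B-phase-injective refl = refl

flat-X : ∀ ts p →
    (Σ ℕ λ m → flat X[ ts ] p ≡ encode (A (phase ts m)))
  ⊎ (Σ ℕ λ m → p ≡ suc (double m) × flat X[ ts ] p ≡ encode (B (phase ts m) m))
flat-X ts p with even⊎odd p
... | m , inj₁ refl = inj₁ (m , trans (⊕-double (σ₁ X[ ts ]) (σ₂ X[ ts ]) m) (col-X ts 1 m))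
... | m , inj₂ refl = inj₂ (m , refl , trans (⊕-suc-double (σ₁ X[ ts ]) (σ₂ X[ ts ]) m) (col-X ts 2 m))

first-⊎ : ∀ {P Q : ℕ → Set} → (∀ k → P k ⊎ Q k) → ∀ N →
  (∀ k → k ≤ N → P k) ⊎ (Σ ℕ λ j → Q j × ∀ k → k < j → P k)
first-⊎ P⊎Q zero with P⊎Q 0
... | inj₁ p = inj₁ λ { zero _ → p }
... | inj₂ q = inj₂ (0 , q , λ _ ())
first-⊎ P⊎Q (suc N) with first-⊎ P⊎Q N
... | inj₂ found = inj₂ found
... | inj₁ all with P⊎Q (suc N)
...   | inj₂ q = inj₂ (suc N , q , λ k k<1+N → all k (≤-pred k<1+N))
...   | inj₁ p = inj₁ λ k k≤1+N → [ (λ k<1+N → all k (≤-pred k<1+N)) , (λ { refl → p }) ]′ (m≤n⇒m<n∨m≡n k≤1+N)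

strictlyIncreasing⇒≥id : ∀ (g : ℕ → ℕ) → (∀ n → g n < g (suc n)) → ∀ n → n ≤ g n
strictlyIncreasing⇒≥id g inc zero    = z≤n
strictlyIncreasing⇒≥id g inc (suc n) = ≤-<-trans (strictlyIncreasing⇒≥id g inc n) (inc n)

module SolutionOf (ts : List ℕ) (Z : Name) (sol : Sol WOPlex2 X[ ts ] Z) where

  L : ℕ
  L = length ts

  g : ℕ → ℕ
  g = proj₁ (proj₂ sol)

  IsATerm IsBTerm : ℕ → Set
  IsATerm k = Σ ℕ λ m → Z k ≡ encode (A (phase ts m))
  IsBTerm k = Σ ℕ λ m → g k ≡ suc (double m) × Z k ≡ encode (B (phase ts m) m)

  term-shape : ∀ k → IsATerm k ⊎ IsBTerm k
  term-shape k with flat-X ts (g k) | proj₂ (proj₂ (proj₂ sol)) k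
  ... | inj₁ (m , e)      | Zk≡ = inj₁ (m , trans Zk≡ e)
  ... | inj₂ (m , g≡ , e) | Zk≡ = inj₂ (m , g≡ , trans Zk≡ e)

  descends : ∀ k x y → Z (suc k) ≡ encode x → Z k ≡ encode y → x ≼ y × x ≢ y
  descends k x y eq eq′ = LtX-encode⇒ ts x y (subst₂ (LtX X[ ts ]) eq eq′ (proj₁ sol k))

  A-prefix-phase-grows : ∀ k → (∀ k′ → k′ ≤ k → IsATerm k′) →
    Σ ℕ λ m → Z k ≡ encode (A (phase ts m)) × k ≤ phase ts m
  A-prefix-phase-grows zero    allA = let (m , e) = allA 0 z≤n in m , e , z≤n
  A-prefix-phase-grows (suc k) allA with A-prefix-phase-grows k (λ k′ k′≤k → allA k′ (m≤n⇒m≤1+n k′≤k))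
  ... | m , e , k≤p with allA (suc k) ≤-refl
  ... | m′ , e′ with descends k (A (phase ts m′)) (A (phase ts m)) e′ e
  ... | p≤p′ , ne = m′ , e′ , ≤-trans (s≤s k≤p) (≤∧≢⇒< p≤p′ λ p≡p′ → ne (cong A (sym p≡p′)))

  some-B-term : Σ ℕ λ j → IsBTerm j × ∀ k → k < j → IsATerm k
  some-B-term with first-⊎ term-shape (suc L)
  ... | inj₂ found = found
  ... | inj₁ allA with A-prefix-phase-grows (suc L) allA
  ...   | m , _ , 1+L≤p = ⊥-elim (n≮n L (≤-trans 1+L≤p (phase-≤-length ts m)))

  B-terms-persist : ∀ j m → g j ≡ suc (double m) → Z j ≡ encode (B (phase ts m) m) → ∀ k →
    Σ ℕ λ m′ → g (k + j) ≡ suc (double m′) × Z (k + j) ≡ encode (B (phase ts m′) m′) × phase ts m′ ≤ phase ts m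
  B-terms-persist j m g≡ Z≡ zero = m , g≡ , Z≡ , ≤-refl
  B-terms-persist j m g≡ Z≡ (suc k) with B-terms-persist j m g≡ Z≡ k
  ... | m′ , _ , Z≡′ , p′≤p with term-shape (suc (k + j))
  ... | inj₁ (m″ , Z≡″) = ⊥-elim (proj₁ (descends (k + j) (A (phase ts m″)) (B (phase ts m′) m′) Z≡″ Z≡′))
  ... | inj₂ (m″ , g≡″ , Z≡″) with proj₁ (descends (k + j) (B (phase ts m″) m″) (B (phase ts m′) m′) Z≡″ Z≡′)
  ...   | inj₁ p″<p′       = m″ , g≡″ , Z≡″ , ≤-trans (<⇒≤ p″<p′) p′≤p
  ...   | inj₂ (p″≡p′ , _) = m″ , g≡″ , Z≡″ , ≤-trans (≤-reflexive p″≡p′) p′≤p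

  -- Later B-terms come from arbitrarily late σ-indices, where the phase is already L.
  B-term-phase : ∀ j m → g j ≡ suc (double m) → Z j ≡ encode (B (phase ts m) m) → phase ts m ≡ L
  B-term-phase j m g≡ Z≡ with m≤n⇒m<n∨m≡n (phase-≤-length ts m)
  ... | inj₂ p≡L = p≡L
  ... | inj₁ p<L with phase-eventually-length ts m p<L
  ... | t , final with B-terms-persist j m g≡ Z≡ (suc (double t))
  ... | m′ , g≡′ , _ , p′≤p = ⊥-elim (n≮n L (≤-<-trans (≤-trans (≤-reflexive (sym (final m′ t≤m′))) p′≤p) p<L))
    where
    t≤m′ : t ≤ m′
    t≤m′ = double-cancel-≤ t m′ (≤-pred (begin
      suc (double t)           ≤⟨ m≤m+n (suc (double t)) j ⟩
      suc (double t) + j       ≤⟨ strictlyIncreasing⇒≥id g (proj₁ (proj₂ (proj₂ sol))) _ ⟩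
      g (suc (double t) + j)   ≡⟨ g≡′ ⟩
      suc (double m′)          ∎))
      where open ≤-Reasoning

  reveals-length : RevealsPhase (λ k v → Z k ≡ v) L
  reveals-length with some-B-term
  ... | j , (m , g≡ , Z≡) , before =
    j , (λ k k<j → Z k , refl , A-term-not-B (before k k<j)) ,
    m , trans Z≡ (cong (λ p → encode (B p m)) (B-term-phase j m g≡ Z≡))
    where
    A-term-not-B : ∀ {k} → IsATerm k → ¬ IsB (Z k)
    A-term-not-B (m , Z≡A) (l , n , Z≡B) with encode-injective {A (phase ts m)} {B l n} (trans (sym Z≡A) Z≡B)
    ... | ()

-- Diagonalisation against K

Converges : Code 1 → Name → ℕ → ℕ → Set
Converges e O k v = Σ ℕ λ s → eval s e O (k ∷ []) ≡ just v

converges-functional : ∀ {e O k v w} → Converges e O k v → Converges e O k w → v ≡ w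
converges-functional {e} {O} {k} (s , eq) (s′ , eq′) = eval-deterministic {s} {s′} e O (k ∷ []) eq eq′

converges-locally : ∀ {e O k v} → Converges e O k v → Locally (λ O′ → Converges e O′ k v) O
converges-locally {e} {O} {k} (s , eq) =
  locally-map (λ same → s , trans same eq) (eval-hasUse s e O (k ∷ []))

locally-∀< : ∀ {P : ℕ → Name → Set} {O} j → (∀ k → k < j → Locally (P k) O) →
  Locally (λ O′ → ∀ k → k < j → P k O′) O
locally-∀<         zero    _   = 0 , λ _ _ _ ()
locally-∀< {P} {O} (suc j) loc = locally-map extend
  (locally-× (locally-∀< j λ k k<j → loc k (m≤n⇒m≤1+n k<j)) (loc j ≤-refl))
  where
  extend : ∀ {O′} → (∀ k → k < j → P k O′) × P j O′ → ∀ k → k < suc j → P k O′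
  extend (below , at) k k<1+j with m≤n⇒m<n∨m≡n (≤-pred k<1+j)
  ... | inj₁ k<j  = below k k<j
  ... | inj₂ refl = at

revealsPhase-locally : ∀ {e O L} → RevealsPhase (Converges e O) L →
  Locally (λ O′ → RevealsPhase (Converges e O′) L) O
revealsPhase-locally (j , before , n , conv) = locally-map (λ (before′ , conv′) → j , before′ , n , conv′)
  (locally-× (locally-∀< j λ k k<j → let (v , c , ¬B) = before k k<j in
                locally-map (λ c′ → v , c′ , ¬B) (converges-locally c))
             (converges-locally conv))

-- A new switch at time t does not change the entries of columns 0–2 at positions below t,
-- and every index below t lies in such a position.
X[]-≈-switch : ∀ t ts → X[ ts ] ≈[ t ] X[ t ∷ ts ]
X[]-≈-switch t ts m m<t with unpair m | pair-unpair m
... | c , k | pair≡m = entry-≡ c (≤-<-trans (≤-trans (s≤pair c k) (≤-reflexive pair≡m)) m<t)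
  where
  entry-≡ : ∀ c → k < t → entry ts (c , k) ≡ entry (t ∷ ts) (c , k)
  entry-≡ 0                   k<t = refl
  entry-≡ 1                   k<t = cong (λ p → encode (A p))   (sym (phase-before t ts k k<t))
  entry-≡ 2                   k<t = cong (λ p → encode (B p k)) (sym (phase-before t ts k k<t))
  entry-≡ (suc (suc (suc _))) k<t = refl

_─_ : {x : Name} (xs : List Name) → x ∈ xs → List Name
xs ─ x∈xs = removeAt xs (index x∈xs)

∈-─ : ∀ {x y : Name} {xs} (x∈xs : x ∈ xs) → y ∈ xs → y ≡ x ⊎ y ∈ xs ─ x∈xs
∈-─ (here x≡z)  (here y≡z)  = inj₁ (trans y≡z (sym x≡z))
∈-─ (here _)    (there y∈)  = inj₂ y∈
∈-─ (there _)   (here y≡z)  = inj₂ (here y≡z)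
∈-─ (there x∈)  (there y∈)  = Data.Sum.map₂ there (∈-─ x∈ y∈)

module Diagonalisation (K : Code 1) where

  Reveals : Name → List ℕ → Set
  Reveals Y ts = RevealsPhase (Converges K (X[ ts ] ⊕ Y)) (length ts)

  Refuted : Name → List ℕ → ℕ → Set
  Refuted Y ts T = Σ ℕ λ l → l < length ts ×
    ∀ X′ → X[ ts ] ≈[ T ] X′ → RevealsPhase (Converges K (X′ ⊕ Y)) l

  refuted⇒¬reveals : ∀ {Y ts T} → Refuted Y ts T → ¬ Reveals Y ts
  refuted⇒¬reveals {ts = ts} (l , l<L , reveals-l) reveals-L =
    <⇒≢ l<L (revealsPhase-unique converges-functional (reveals-l X[ ts ] ≈-refl) reveals-L)

  refuted-after-switch : ∀ {Y ts T} t → T ≤ t → Refuted Y ts T → Refuted Y (t ∷ ts) t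
  refuted-after-switch {ts = ts} t T≤t (l , l<L , reveals-l) =
    l , m≤n⇒m≤1+n l<L , λ X′ ag → reveals-l X′ (≈-mono T≤t (≈-trans (X[]-≈-switch t ts) ag))

  -- K has read only finitely much of X[ ts ] when it reveals the phase, so a later switch refutes Y.
  reveals⇒refuted-after-switch : ∀ {Y ts} → Reveals Y ts →
    Σ ℕ λ u → ∀ t → u ≤ t → Refuted Y (t ∷ ts) t
  reveals⇒refuted-after-switch {Y} {ts} reveals with revealsPhase-locally reveals
  ... | u , stable = u , λ t u≤t → length ts , ≤-refl , λ X′ ag →
    stable (X′ ⊕ Y) (≈-⊕ Y (≈-mono u≤t (≈-trans (X[]-≈-switch t ts) ag)))

  module _ (Ys : List Name) (T₀ : ℕ) where

    Escaped : List ℕ → Set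
    Escaped ts = X[ [] ] ≈[ T₀ ] X[ ts ] × ∀ Y → Y ∈ Ys → ¬ Reveals Y ts

    -- Each round refutes one of the finitely many answers that are still live.
    escape-from : ∀ c (Live : List Name) ts T → length Live ≡ c →
      (∀ Y → Y ∈ Ys → Y ∈ Live ⊎ Refuted Y ts T) → X[ [] ] ≈[ T₀ ] X[ ts ] → T₀ ≤ T →
      ¬ ¬ Σ (List ℕ) Escaped
    escape-from c Live ts T len live⊎refuted ag T₀≤T noEscape = ¬¬-excluded-middle λ
      { (no noneReveals) → noEscape (ts , ag , λ Y Y∈Ys reveals →
          [ (λ Y∈Live → noneReveals (Y , Y∈Live , reveals)) , (λ ref → refuted⇒¬reveals ref reveals) ]′
            (live⊎refuted Y Y∈Ys))
      ; (yes (Y , Y∈Live , reveals)) → switch c len Y Y∈Live reveals }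
      where
      switch : ∀ c → length Live ≡ c → ∀ Y → Y ∈ Live → Reveals Y ts → ⊥
      switch zero len Y Y∈Live _ = 1+n≢0 (trans (sym (length-removeAt′ Live (index Y∈Live))) len)
      switch (suc c) len Y Y∈Live reveals with reveals⇒refuted-after-switch reveals
      ... | u , refuted-after = escape-from c (Live ─ Y∈Live) (t ∷ ts) t
            (suc-injective (trans (sym (length-removeAt′ Live (index Y∈Live))) len))
            still (≈-trans ag (≈-mono T₀≤t (X[]-≈-switch t ts))) T₀≤t noEscape
        where
        t = T ⊔ u
        T₀≤t = ≤-trans T₀≤T (m≤m⊔n T u)
        still : ∀ Y′ → Y′ ∈ Ys → Y′ ∈ Live ─ Y∈Live ⊎ Refuted Y′ (t ∷ ts) t
        still Y′ Y′∈Ys with live⊎refuted Y′ Y′∈Ys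
        ... | inj₂ ref = inj₂ (refuted-after-switch t (m≤m⊔n T u) ref)
        ... | inj₁ Y′∈Live with ∈-─ Y∈Live Y′∈Live
        ...   | inj₂ Y′∈rest = inj₁ Y′∈rest
        ...   | inj₁ refl    = inj₂ (refuted-after t (m≤n⊔m T u))

    escape : ¬ ¬ Σ (List ℕ) Escaped
    escape = escape-from (length Ys) Ys [] T₀ refl (λ Y Y∈Ys → inj₁ Y∈Ys) ≈-refl ≤-refl

-- Finitely many candidate answers to LPO′*

LPO′-solvable : ∀ p → Inst LPO′ p → ¬ ¬ Σ ℕ λ b → b ≤ 1 × Sol LPO′ p (λ _ → b)
LPO′-solvable p (binary , limits) noAnswer = ¬¬-excluded-middle λ
  { (yes some1) → noAnswer (1 , ≤-refl , inj₂ (refl , some1))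
  ; (no  no1)   → noAnswer (0 , z≤n , inj₁ (refl , λ i → limit-0 i no1)) }
  where
  limit-0 : ∀ i → ¬ (Σ ℕ λ i → LimIs p i 1) → LimIs p i 0
  limit-0 i no1 with limits i
  ... | zero        , limit       = limit
  ... | suc zero    , limit       = ⊥-elim (no1 (i , limit))
  ... | suc (suc _) , s₀ , stable =
    ⊥-elim (<⇒≱ (s≤s (s≤s z≤n)) (subst (_≤ 1) (stable s₀ ≤-refl) (binary (pair i s₀))))

infixr 5 _∷ᶠ_

_∷ᶠ_ : ℕ → (ℕ → ℕ) → ℕ → ℕ
(b ∷ᶠ β) zero    = b
(b ∷ᶠ β) (suc i) = β i

LPO′-parallel-solvable : ∀ (P : ℕ → Name) m → (∀ i → i < m → Inst LPO′ (P i)) →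
  ¬ ¬ Σ (ℕ → ℕ) λ β → ∀ i → i < m → β i ≤ 1 × Sol LPO′ (P i) (λ _ → β i)
LPO′-parallel-solvable P zero    _    noAnswer = noAnswer ((λ _ → 0) , λ _ ())
LPO′-parallel-solvable P (suc m) inst noAnswer =
  LPO′-solvable (P 0) (inst 0 (s≤s z≤n)) λ (b , b≤1 , solves) →
  LPO′-parallel-solvable (λ i → P (suc i)) m (λ i i<m → inst (suc i) (s≤s i<m)) λ (β , solveβ) →
  noAnswer (b ∷ᶠ β , λ { zero _ → b≤1 , solves ; (suc i) (s≤s i<m) → solveβ i i<m })

bitStrings : ℕ → List (ℕ → ℕ)
bitStrings zero    = (λ _ → 0) ∷ []
bitStrings (suc n) = map (0 ∷ᶠ_) (bitStrings n) ++ map (1 ∷ᶠ_) (bitStrings n)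

bitStrings-complete : ∀ n (β : ℕ → ℕ) → (∀ i → i < n → β i ≤ 1) →
  Σ (ℕ → ℕ) λ γ → γ ∈ bitStrings n × ∀ i → i < n → γ i ≡ β i
bitStrings-complete zero    β _   = (λ _ → 0) , here refl , λ _ ()
bitStrings-complete (suc n) β bin with bitStrings-complete n (λ i → β (suc i)) (λ i i<n → bin (suc i) (s≤s i<n))
... | γ , γ∈ , γ≡ with β 0 in β0≡ | bin 0 (s≤s z≤n)
...   | zero        | _ = 0 ∷ᶠ γ , ∈-++⁺ˡ (∈-map⁺ (0 ∷ᶠ_) γ∈) , λ { zero _ → sym β0≡ ; (suc i) (s≤s i<n) → γ≡ i i<n }
...   | suc zero    | _ = 1 ∷ᶠ γ , ∈-++⁺ʳ _ (∈-map⁺ (1 ∷ᶠ_) γ∈) , λ { zero _ → sym β0≡ ; (suc i) (s≤s i<n) → γ≡ i i<n }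
...   | suc (suc _) | s≤s ()

answerName : (ℕ → ℕ) → Name
answerName γ m = γ (proj₁ (unpair m))

answers : ℕ → List Name
answers n = map answerName (bitStrings n)

LPO′*-solved-among-answers : ∀ W → Inst (LPO′ *) W →
  ¬ ¬ Σ Name λ Y → Y ∈ answers (W 0) × Sol (LPO′ *) W Y
LPO′*-solved-among-answers W inst noAnswer =
  LPO′-parallel-solvable P (W 0) inst λ (β , solveβ) →
  let (γ , γ∈ , γ≡β) = bitStrings-complete (W 0) β (λ i i<n → proj₁ (solveβ i i<n)) in
  noAnswer (answerName γ , ∈-map⁺ answerName γ∈ , λ i i<n →
    subst (λ b → Sol LPO′ (P i) (λ _ → b))
      (sym (trans (cong (λ (i , _) → γ i) (unpair-pair i 0)) (γ≡β i i<n)))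
      (proj₂ (solveβ i i<n)))
  where
  P : ℕ → Name
  P = col (λ k → W (suc k))

computes⇒converges : ∀ {e O Z k v} → Computes e O Z → Z k ≡ v → Converges e O k v
computes⇒converges {k = k} computes refl = computes k

mainTheorem11 : ¬ (WOPlex2 ≤W (LPO′ *))
mainTheorem11 (H , K , reduction) with reduction X[ [] ] (X[]-instance [])
... | HX₀ , H-computes₀ , _ with converges-locally (H-computes₀ 0)
... | T₀ , H-committed = escape (answers (HX₀ 0)) T₀ λ (ts , X[]≈ , noneReveals) →
  let (HX , H-computes , HX-instance , K-solves) = reduction X[ ts ] (X[]-instance ts)
      same-count : HX 0 ≡ HX₀ 0
      same-count = converges-functional (H-computes 0) (H-committed X[ ts ] X[]≈)
  in LPO′*-solved-among-answers HX HX-instance λ (Y , Y∈answers , Y-solves) →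
  let (Z , K-computes , Z-solves) = K-solves Y Y-solves in
  noneReveals Y (subst (λ n → Y ∈ answers n) same-count Y∈answers)
    (revealsPhase-map (computes⇒converges K-computes) (SolutionOf.reveals-length ts Z Z-solves))
  where open Diagonalisation K
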